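{- Let $(G,T)$ be a graft, let $F$ be a minimum join of $(G,T)$, and let $X\subseteq V(G)$ be $F$-combic. Then: (i) For every $C\in \mathrm{Odd}_T(G-X)$, let $e_C$ be the unique edge of $\delta_G(V(C))\cap F$ and let $r_C\in V(C)$ be the end of $e_C$ lying in $C$. Then $F\cap E(C)$ is a minimum join of the graft $(C,(T\cap V(C))\,\Delta\,\{r_C\})$. (ii) For every $C\in \mathrm{Even}_T(G-X)$, $F\cap E(C)$ is a minimum join of the graft $(C, T\cap V(C))$. (iii) $F\cap \bigcup\{\delta_G(V(C)) : C\in \mathrm{Odd}_T(G-X)\}$ is a minimum join of the skeleton $\mathrm{Sk}(G,T;X)$.
   Context: All graphs are finite (parallel edges allowed). A graft is a pair $(G,T)$ with $G$ a graph and $T\subseteq V(G)$. A join of $(G,T)$ is a set $F\subseteq E(G)$ such that every vertex $v$ is incident to an odd number of edges of $F$ if $v\in T$ and to an even number otherwise; a minimum join is a join of minimum cardinality. For $Y\subseteq V(G)$, $\delta_G(Y)$ is the set of edges with exactly one end in $Y$, and $E_G[Y]$ is the set of edges with both ends in $Y$. For a graph $H$ and a set $T$, $\mathrm{Odd}_T(H)$ (resp. $\mathrm{Even}_T(H)$) is the set of connected components $C$ of $H$ with $|V(C)\cap T|$ odd (resp. even). Given a minimum join $F$, a set $X\subseteq V(G)$ is $F$-combic if (a) $E_G[X]\cap F=\emptyset$; (b) $|\delta_G(V(C))\cap F|=1$ for every $C\in\mathrm{Odd}_T(G-X)$; (c) $\delta_G(V(C))\cap F=\emptyset$ for every $C\in\mathrm{Even}_T(G-X)$.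 Contraction of a graft $(H,S)$ by disjoint vertex sets $Y_1,\dots,Y_k$: each $Y_i$ is identified into a single new vertex $[Y_i]$ (edges inside $Y_i$ are deleted, the other edges are kept with ends redirected), and $[Y_i]$ belongs to the new terminal set iff $|S\cap Y_i|$ is odd, while other vertices keep their membership. If $X$ is $F$-combic, let $H:=G-E_G[X]-\bigcup\{V(C): C\in\mathrm{Even}_T(G-X)\}$ and $S:=T\cap V(H)$; the skeleton $\mathrm{Sk}(G,T;X)$ is the graft obtained from $(H,S)$ by contracting $V(C)$ for every $C\in\mathrm{Odd}_T(G-X)$. It is a bipartite graft whose edges are identified with the edges of $G$ between $X$ and $\bigcup\{V(C):C\in\mathrm{Odd}_T(G-X)\}$. -}

module Defs where

open import Data.Nat using (ℕ; zero; suc; _+_; _≤_)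
open import Data.Nat.DivMod using (_%_)
open import Data.Bool using (Bool; true; false; if_then_else_; _xor_; _∧_)
open import Data.Fin using (Fin; _≟_)
open import Data.Fin.Subset using (Subset; _∈_; _∉_; ∣_∣; _∩_)
open import Data.Vec using (Vec; lookup; tabulate; zipWith)
open import Data.List using (List; map; allFin)
open import Data.Nat.ListAction using (sum)
open import Data.Product using (_×_; _,_; proj₁; proj₂; Σ; ∃)
open import Data.Sum using (_⊎_)
open import Relation.Nullary using (¬_; does)
open import Relation.Binary.PropositionalEquality using (_≡_)

record Graph (n m : ℕ) : Set where
  field
    ends : Fin m → Fin n × Fin n
open Graph public

_⇔_ : Set → Set → Set
A ⇔ B = (A → B) × (B → A)

Odd : ℕ → Set
Odd k = k % 2 ≡ 1

_Δ_ : ∀ {n} → Subset n → Subset n → Subset n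
A Δ B = zipWith _xor_ A B

module _ {n m : ℕ} (G : Graph n m) where

  EndOf : Fin n → Fin m → Set
  EndOf v e = (v ≡ proj₁ (ends G e)) ⊎ (v ≡ proj₂ (ends G e))

  -- number of ends of e equal to v (a loop counts twice)
  inc : Fin n → Fin m → ℕ
  inc v e = (if does (v ≟ proj₁ (ends G e)) then 1 else 0)
          + (if does (v ≟ proj₂ (ends G e)) then 1 else 0)

  Σₑ : (Fin m → ℕ) → ℕ
  Σₑ f = sum (map f (allFin m))

  deg : Subset m → Fin n → ℕ
  deg F v = Σₑ (λ e → if lookup F e then inc v e else 0)

  bothIn : Subset n → Fin m → Bool
  bothIn Y e = lookup Y (proj₁ (ends G e)) ∧ lookup Y (proj₂ (ends G e))

  crosses : Subset n → Fin m → Bool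
  crosses Y e = lookup Y (proj₁ (ends G e)) xor lookup Y (proj₂ (ends G e))

  E[_] : Subset n → Subset m
  E[ Y ] = tabulate (bothIn Y)

  δ : Subset n → Subset m
  δ Y = tabulate (crosses Y)

  IsJoin : Subset n → Subset m → Set
  IsJoin T F = ∀ v → Odd (deg F v) ⇔ (v ∈ T)

  IsMinJoin : Subset n → Subset m → Set
  IsMinJoin T F = IsJoin T F × (∀ F' → IsJoin T F' → ∣ F ∣ ≤ ∣ F' ∣)

  -- Joins of the graft (G[U], T') where G[U] is the subgraph induced by U
  -- (vertex set U, edge set E_G[U]); degrees in G[U] of edges of E_G[U]
  -- coincide with degrees in G.
  IsJoinOn : Subset n → Subset n → Subset m → Set
  IsJoinOn U T' F = (∀ e → e ∈ F → e ∈ E[ U ])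
                  × (∀ v → v ∈ U → Odd (deg F v) ⇔ (v ∈ T'))

  IsMinJoinOn : Subset n → Subset n → Subset m → Set
  IsMinJoinOn U T' F = IsJoinOn U T' F
                     × (∀ F' → IsJoinOn U T' F' → ∣ F ∣ ≤ ∣ F' ∣)

  -- walks in G - X (every vertex of the walk except possibly a trivial
  -- start avoids X)
  data Walk (X : Subset n) : Fin n → Fin n → Set where
    here : ∀ {v} → Walk X v v
    step : ∀ {u v w} (e : Fin m) →
           (ends G e ≡ (u , v) ⊎ ends G e ≡ (v , u)) →
           u ∉ X → v ∉ X → Walk X v w → Walk X u w

  IsComponent : Subset n → Subset n → Set
  IsComponent X U =
      (∃ λ u → u ∈ U)
    × (∀ u → u ∈ U → u ∉ X)
    × (∀ u v → u ∈ U → v ∈ U → Walk X u v)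
    × (∀ u v → u ∈ U → v ∉ X → Walk X u v → v ∈ U)

  OddComp : Subset n → Subset n → Subset n → Set
  OddComp T X U = IsComponent X U × Odd ∣ T ∩ U ∣

  EvenComp : Subset n → Subset n → Subset n → Set
  EvenComp T X U = IsComponent X U × ¬ Odd ∣ T ∩ U ∣

  cut : Subset m → Subset n → ℕ
  cut F U = ∣ δ U ∩ F ∣

  IsCombic : Subset n → Subset m → Subset n → Set
  IsCombic T F X =
      (∀ e → e ∈ F → e ∉ E[ X ])
    × (∀ U → OddComp T X U → cut F U ≡ 1)
    × (∀ U → EvenComp T X U → cut F U ≡ 0)

  -- The skeleton Sk(G,T;X), written out.
  -- Vertices: the vertices of X, and one vertex [C] per C ∈ Odd_T(G-X).
  -- Edges: the edges of G between X and ⋃{V(C) : C ∈ Odd_T(G-X)}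
  -- (all other edges of H are deleted by the contraction or are absent
  -- from H).  Terminals: x ∈ X is a terminal iff x ∈ T; [C] is a
  -- terminal iff |T ∩ V(C)| is odd.  The degree of [C] w.r.t. an edge
  -- set F' of the skeleton is |δ_G(V(C)) ∩ F'|.

  InOddComp : Subset n → Subset n → Fin n → Set
  InOddComp T X v = Σ (Subset n) λ U → OddComp T X U × v ∈ U

  SkEdge : Subset n → Subset n → Fin m → Set
  SkEdge T X e =
      (proj₁ (ends G e) ∈ X × InOddComp T X (proj₂ (ends G e)))
    ⊎ (proj₂ (ends G e) ∈ X × InOddComp T X (proj₁ (ends G e)))

  IsSkJoin : Subset n → Subset n → Subset m → Set
  IsSkJoin T X F' =
      (∀ e → e ∈ F' → SkEdge T X e)
    × (∀ x → x ∈ X → Odd (deg F' x) ⇔ (x ∈ T))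
    × (∀ U → OddComp T X U → Odd (cut F' U) ⇔ Odd ∣ T ∩ U ∣)

  IsSkMinJoin : Subset n → Subset n → Subset m → Set
  IsSkMinJoin T X F' = IsSkJoin T X F'
                     × (∀ F'' → IsSkJoin T X F'' → ∣ F' ∣ ≤ ∣ F'' ∣)

-- Inside a component C of G − X, an edge of F at a vertex of C lies either in E(C) or in
-- δ(C) ∩ F, which is empty for even C and the single edge e_C for odd C.  Hence F ∩ E(C)
-- has the parities of a join of (C, T ∩ V(C)), resp. (C, (T ∩ V(C)) Δ {r_C}), and it is a
-- minimum one since a cheaper join of C could be exchanged for it inside F.  For the
-- skeleton, conditions (a) and (c) force every edge of F at X to end in an odd component,
-- so F' has the degrees of F on X and one edge in each odd cut; as a skeleton edge lies in
-- the cut of only one odd component, every skeleton join has at least |F'| edges.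

module Submission where

open import Defs
open import Data.Nat using (ℕ; zero; suc; _+_; _≤_; _<_; z≤n; s≤s)
  renaming (_≟_ to _≟ℕ_)
open import Data.Nat.Properties
  using (+-comm; +-identityʳ; +-suc; +-monoʳ-≤; +-cancelˡ-≤; ≤-trans; m≤m+n; <⇒≱;
         +-0-commutativeMonoid; module ≤-Reasoning)
open import Data.Nat.DivMod using (_%_; %-distribˡ-+; m%n<n)
import Data.Nat.ListAction as ListAction
open import Data.Bool using (true; false; if_then_else_; _xor_; _∧_; _∨_)
open import Data.Bool.Properties using (if-cong; if-eta; xor-identityʳ)
open import Data.Fin using (Fin; zero; suc; _≟_; punchIn)
open import Data.Fin.Properties using (any?; punchInᵢ≢i; 0≢1+n; suc-injective)
open import Data.Fin.Subset
  using (Subset; _∈_; _∉_; _⊆_; ∣_∣; _∩_; _∪_; ∁; ⁅_⁆; ⊥; ⊤; _-_; Nonempty; Empty)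
open import Data.Fin.Subset.Properties
  using (_∈?_; ⊆-refl; ⊆-trans; ⊆-antisym; ∉⊥; x∈⁅x⁆; x∈⁅y⁆⇒x≡y; x≢y⇒x∉⁅y⁆; ∣⁅x⁆∣≡1;
         ∣⊥∣≡0; ∣p∣≤n; p⊆q⇒∣p∣≤∣q∣; p⊂q⇒∣p∣<∣q∣; x∈p⇒∣p-x∣<∣p∣; x∈p∧x≢y⇒x∈p-y;
         x∈p∩q⁺; x∈p∩q⁻; x∈∁p⇒x∉p; x∉p⇒x∈∁p; Empty-unique; nonempty?;
         ∩-identityʳ; ∪-inverseʳ; ∩-distribˡ-∪)
open import Data.Vec using ([]; _∷_; here; there; lookup; tabulate)
open import Data.Vec.Properties
  using (lookup⇒[]=; []=⇒lookup; lookup∘tabulate; lookup-zipWith; lookup-replicate)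
import Data.List as List
open import Data.List.Properties using (map-tabulate)
open import Data.Product using (_×_; _,_; proj₁; proj₂; Σ; ∃)
open import Data.Product.Properties using (≡-dec)
open import Data.Sum using (_⊎_; inj₁; inj₂; swap)
open import Function using (id; _∘_)
open import Relation.Nullary
  using (¬_; Dec; yes; no; does; contradiction; ¬?; _×-dec_; _⊎-dec_; decidable-stable)
open import Relation.Nullary.Decidable using (dec-true)
open import Relation.Binary.PropositionalEquality hiding (J)
open import Algebra.Properties.CommutativeMonoid.Sum +-0-commutativeMonoid
  using (sum; sum-cong-≗; sum-remove; sum-replicate-zero; ∑-distrib-+)

infixr 2 _⟨⇔⟩_

_⟨⇔⟩_ : ∀ {A B C : Set} → A ⇔ B → B ⇔ C → A ⇔ C
(f , g) ⟨⇔⟩ (h , k) = h ∘ f , g ∘ k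

⇔-sym : ∀ {A B : Set} → A ⇔ B → B ⇔ A
⇔-sym (f , g) = g , f

¬-cong : ∀ {A B : Set} → A ⇔ B → (¬ A) ⇔ (¬ B)
¬-cong (f , g) = (λ ¬a → ¬a ∘ g) , (λ ¬b → ¬b ∘ f)

odd? : ∀ k → Dec (Odd k)
odd? k = k % 2 ≟ℕ 1

≡⇒Odd⇔ : ∀ {a b} → a ≡ b → Odd a ⇔ Odd b
≡⇒Odd⇔ a≡b = subst Odd a≡b , subst Odd (sym a≡b)

%2≡0⊎%2≡1 : ∀ k → k % 2 ≡ 0 ⊎ k % 2 ≡ 1
%2≡0⊎%2≡1 k with k % 2 | m%n<n k 2
... | 0           | _               = inj₁ refl
... | 1           | _               = inj₂ refl
... | suc (suc _) | s≤s (s≤s ())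

Odd⇔⇒%2≡ : ∀ {a b} → Odd a ⇔ Odd b → a % 2 ≡ b % 2
Odd⇔⇒%2≡ {a} {b} (a⇒b , b⇒a) with %2≡0⊎%2≡1 a | %2≡0⊎%2≡1 b
... | inj₁ a0 | inj₁ b0 = trans a0 (sym b0)
... | inj₂ a1 | inj₂ b1 = trans a1 (sym b1)
... | inj₁ a0 | inj₂ b1 = contradiction (trans (sym a0) (b⇒a b1)) λ ()
... | inj₂ a1 | inj₁ b0 = contradiction (trans (sym b0) (a⇒b a1)) λ ()

Odd-+-congˡ : ∀ c {a b} → Odd a ⇔ Odd b → Odd (c + a) ⇔ Odd (c + b)
Odd-+-congˡ c {a} {b} a⇔b = trans (sym same) , trans same
  where
  open ≡-Reasoning
  same : (c + a) % 2 ≡ (c + b) % 2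
  same = begin
    (c + a) % 2           ≡⟨ %-distribˡ-+ c a 2 ⟩
    (c % 2 + a % 2) % 2   ≡⟨ cong (λ x → (c % 2 + x) % 2) (Odd⇔⇒%2≡ {a} {b} a⇔b) ⟩
    (c % 2 + b % 2) % 2   ≡⟨ %-distribˡ-+ c b 2 ⟨
    (c + b) % 2           ∎

Odd[d+1]⇔¬Odd[d] : ∀ d → Odd (d + 1) ⇔ (¬ Odd d)
Odd[d+1]⇔¬Odd[d] d with %2≡0⊎%2≡1 d
... | inj₁ d0 = (λ _ d1 → contradiction (trans (sym d0) d1) λ ())
              , (λ _ → trans (%-distribˡ-+ d 1 2) (cong (λ x → (x + 1) % 2) d0))
... | inj₂ d1 = (λ odd → contradiction (trans (sym odd) (trans (%-distribˡ-+ d 1 2)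
                                                         (cong (λ x → (x + 1) % 2) d1))) λ ())
              , (λ ¬odd → contradiction d1 ¬odd)

Odd[d+1]⇔P⇒Odd[d]⇔¬P : ∀ {d} {P : Set} → Odd (d + 1) ⇔ P → Odd d ⇔ (¬ P)
Odd[d+1]⇔P⇒Odd[d]⇔¬P {d} (odd⇒P , P⇒odd) =
    (λ odd p → proj₁ (Odd[d+1]⇔¬Odd[d] d) (P⇒odd p) odd)
  , (λ ¬p → decidable-stable (odd? d) (λ ¬odd → ¬p (odd⇒P (proj₂ (Odd[d+1]⇔¬Odd[d] d) ¬odd))))

∈⇒lookup : ∀ {k} {p : Subset k} {x} → x ∈ p → lookup p x ≡ true
∈⇒lookup = []=⇒lookup

lookup⇒∈ : ∀ {k} {p : Subset k} {x} → lookup p x ≡ true → x ∈ p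
lookup⇒∈ {p = p} {x} = lookup⇒[]= x p

lookup⇒∉ : ∀ {k} {p : Subset k} {x} → lookup p x ≡ false → x ∉ p
lookup⇒∉ eq x∈p with trans (sym eq) (∈⇒lookup x∈p)
... | ()

∉⇒lookup : ∀ {k} {p : Subset k} {x} → x ∉ p → lookup p x ≡ false
∉⇒lookup {p = p} {x} x∉p with lookup p x in eq
... | true  = contradiction (lookup⇒∈ eq) x∉p
... | false = refl

∈⇔⇒lookup≡ : ∀ {k} {p q : Subset k} {x} → (x ∈ p) ⇔ (x ∈ q) → lookup p x ≡ lookup q x
∈⇔⇒lookup≡ {q = q} {x} (p⇒q , q⇒p) with lookup q x in eq
... | true  = ∈⇒lookup (q⇒p (lookup⇒∈ eq))
... | false = ∉⇒lookup (lookup⇒∉ eq ∘ p⇒q)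

∈∩⇔ : ∀ {k} {p q : Subset k} {x} → x ∈ q → (x ∈ p) ⇔ (x ∈ p ∩ q)
∈∩⇔ x∈q = (λ x∈p → x∈p∩q⁺ (x∈p , x∈q)) , (λ x∈p∩q → proj₁ (x∈p∩q⁻ _ _ x∈p∩q))

lookup≡⇒∈⇔ : ∀ {k} {p q : Subset k} {x} → lookup p x ≡ lookup q x → (x ∈ p) ⇔ (x ∈ q)
lookup≡⇒∈⇔ eq = (λ x∈p → lookup⇒∈ (trans (sym eq) (∈⇒lookup x∈p)))
              , (λ x∈q → lookup⇒∈ (trans eq (∈⇒lookup x∈q)))

∈Δ-∉ : ∀ {k} {p q : Subset k} {x} → x ∉ q → (x ∈ p Δ q) ⇔ (x ∈ p)
∈Δ-∉ {p = p} {q} {x} x∉q = lookup≡⇒∈⇔ (begin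
  lookup (p Δ q) x          ≡⟨ lookup-zipWith _xor_ x p q ⟩
  lookup p x xor lookup q x ≡⟨ cong (lookup p x xor_) (∉⇒lookup x∉q) ⟩
  lookup p x xor false      ≡⟨ xor-identityʳ _ ⟩
  lookup p x                ∎)
  where open ≡-Reasoning

∈Δ-∈ : ∀ {k} {p q : Subset k} {x} → x ∈ q → (x ∈ p Δ q) ⇔ (x ∉ p)
∈Δ-∈ {p = p} {q} {x} x∈q with lookup p x in eq
... | true  = (λ x∈pΔq → contradiction x∈pΔq (lookup⇒∉ flipped))
            , (λ x∉p → contradiction (lookup⇒∈ eq) x∉p)
  where
  flipped : lookup (p Δ q) x ≡ false
  flipped = trans (lookup-zipWith _xor_ x p q) (cong₂ _xor_ eq (∈⇒lookup x∈q))
... | false = (λ _ → lookup⇒∉ eq) , (λ _ → lookup⇒∈ flipped)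
  where
  flipped : lookup (p Δ q) x ≡ true
  flipped = trans (lookup-zipWith _xor_ x p q) (cong₂ _xor_ eq (∈⇒lookup x∈q))

sumOver : ∀ {k} → Subset k → (Fin k → ℕ) → ℕ
sumOver A w = sum λ i → if lookup A i then w i else 0

sumOver-cong : ∀ {k} {A B : Subset k} (w : Fin k → ℕ) →
               (∀ i → w i ≡ 0 ⊎ ((i ∈ A) ⇔ (i ∈ B))) → sumOver A w ≡ sumOver B w
sumOver-cong {A = A} {B} w agree = sum-cong-≗ pointwise
  where
  pointwise : ∀ i → (if lookup A i then w i else 0) ≡ (if lookup B i then w i else 0)
  pointwise i with agree i
  ... | inj₂ A⇔B = if-cong (∈⇔⇒lookup≡ A⇔B)
  ... | inj₁ wi≡0 rewrite wi≡0 = trans (if-eta (lookup A i)) (sym (if-eta (lookup B i)))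

sumOver-⊥ : ∀ {k} (w : Fin k → ℕ) → sumOver ⊥ w ≡ 0
sumOver-⊥ {k} w = trans (sum-cong-≗ {k} λ i → if-cong (lookup-replicate i false)) (sum-replicate-zero k)

sumOver-⁅⁆ : ∀ {k} (j : Fin k) (w : Fin k → ℕ) → sumOver ⁅ j ⁆ w ≡ w j
sumOver-⁅⁆ {suc k} j w = begin
  sumOver ⁅ j ⁆ w               ≡⟨ sum-remove {i = j} t ⟩
  t j + sum (t ∘ punchIn j)     ≡⟨ cong₂ _+_ (if-cong (∈⇒lookup (x∈⁅x⁆ j)))
                                             (trans (sum-cong-≗ off) (sum-replicate-zero k)) ⟩
  w j + 0                       ≡⟨ +-identityʳ (w j) ⟩
  w j                           ∎
  where
  open ≡-Reasoning
  t : Fin (suc k) → ℕ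
  t i = if lookup ⁅ j ⁆ i then w i else 0
  off : ∀ i → t (punchIn j i) ≡ 0
  off i = if-cong (∉⇒lookup (x≢y⇒x∉⁅y⁆ (punchInᵢ≢i j i)))

sumOver-∪ : ∀ {k} {A B : Subset k} (w : Fin k → ℕ) → Empty (A ∩ B) →
            sumOver (A ∪ B) w ≡ sumOver A w + sumOver B w
sumOver-∪ {A = A} {B} w disjoint = trans (sum-cong-≗ pointwise) (∑-distrib-+ (restrict A) (restrict B))
  where
  restrict : Subset _ → Fin _ → ℕ
  restrict S i = if lookup S i then w i else 0
  pointwise : ∀ i → (if lookup (A ∪ B) i then w i else 0)
                  ≡ (if lookup A i then w i else 0) + (if lookup B i then w i else 0)
  pointwise i rewrite lookup-zipWith _∨_ i A B with lookup A i in a | lookup B i in b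
  ... | true  | true  = contradiction (i , x∈p∩q⁺ (lookup⇒∈ a , lookup⇒∈ b)) disjoint
  ... | true  | false = sym (+-identityʳ (w i))
  ... | false | _     = refl

sumOver-split : ∀ {k} (A B : Subset k) (w : Fin k → ℕ) →
                sumOver A w ≡ sumOver (A ∩ B) w + sumOver (A ∩ ∁ B) w
sumOver-split A B w = trans (cong (λ S → sumOver S w) partition) (sumOver-∪ w disjoint)
  where
  open ≡-Reasoning
  partition : A ≡ (A ∩ B) ∪ (A ∩ ∁ B)
  partition = begin
    A                       ≡⟨ ∩-identityʳ A ⟨
    A ∩ ⊤                   ≡⟨ cong (A ∩_) (∪-inverseʳ B) ⟨
    A ∩ (B ∪ ∁ B)           ≡⟨ ∩-distribˡ-∪ A B (∁ B) ⟩
    (A ∩ B) ∪ (A ∩ ∁ B)     ∎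
  disjoint : Empty ((A ∩ B) ∩ (A ∩ ∁ B))
  disjoint (x , x∈both) with x∈p∩q⁻ (A ∩ B) _ x∈both
  ... | x∈A∩B , x∈A∩∁B = x∈∁p⇒x∉p (proj₂ (x∈p∩q⁻ A _ x∈A∩∁B)) (proj₂ (x∈p∩q⁻ A B x∈A∩B))

∣∣≡sumOver : ∀ {k} (A : Subset k) → ∣ A ∣ ≡ sumOver A (λ _ → 1)
∣∣≡sumOver []          = refl
∣∣≡sumOver (true ∷ A)  = cong suc (∣∣≡sumOver A)
∣∣≡sumOver (false ∷ A) = ∣∣≡sumOver A

∣∪∣≡∣∣+∣∣ : ∀ {k} {A B : Subset k} → Empty (A ∩ B) → ∣ A ∪ B ∣ ≡ ∣ A ∣ + ∣ B ∣
∣∪∣≡∣∣+∣∣ {A = A} {B} disjoint = begin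
  ∣ A ∪ B ∣                                  ≡⟨ ∣∣≡sumOver (A ∪ B) ⟩
  sumOver (A ∪ B) _                          ≡⟨ sumOver-∪ _ disjoint ⟩
  sumOver A (λ _ → 1) + sumOver B (λ _ → 1)  ≡⟨ cong₂ _+_ (∣∣≡sumOver A) (∣∣≡sumOver B) ⟨
  ∣ A ∣ + ∣ B ∣                              ∎
  where open ≡-Reasoning

∣∣-split : ∀ {k} (A B : Subset k) → ∣ A ∣ ≡ ∣ A ∩ B ∣ + ∣ A ∩ ∁ B ∣
∣∣-split A B = begin
  ∣ A ∣                                                 ≡⟨ ∣∣≡sumOver A ⟩
  sumOver A _                                           ≡⟨ sumOver-split A B _ ⟩
  sumOver (A ∩ B) (λ _ → 1) + sumOver (A ∩ ∁ B) (λ _ → 1)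
    ≡⟨ cong₂ _+_ (∣∣≡sumOver (A ∩ B)) (∣∣≡sumOver (A ∩ ∁ B)) ⟨
  ∣ A ∩ B ∣ + ∣ A ∩ ∁ B ∣                               ∎
  where open ≡-Reasoning

x∈p⇒0<∣p∣ : ∀ {k} {p : Subset k} {x} → x ∈ p → 0 < ∣ p ∣
x∈p⇒0<∣p∣ {p = p} {x} x∈p =
  subst (_≤ ∣ p ∣) (∣⁅x⁆∣≡1 x) (p⊆q⇒∣p∣≤∣q∣ λ y∈⁅x⁆ → subst (_∈ p) (sym (x∈⁅y⁆⇒x≡y x y∈⁅x⁆)) x∈p)

∣p∣≡0⇒p≡⊥ : ∀ {k} {p : Subset k} → ∣ p ∣ ≡ 0 → p ≡ ⊥
∣p∣≡0⇒p≡⊥ ∣p∣≡0 = Empty-unique λ (x , x∈p) → contradiction (subst (0 <_) ∣p∣≡0 (x∈p⇒0<∣p∣ x∈p)) λ ()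

∣p∣≡1⇒p≡⁅x⁆ : ∀ {k} {p : Subset k} {x} → ∣ p ∣ ≡ 1 → x ∈ p → p ≡ ⁅ x ⁆
∣p∣≡1⇒p≡⁅x⁆ {p = p} {x} ∣p∣≡1 x∈p = ⊆-antisym p⊆⁅x⁆ λ y∈⁅x⁆ → subst (_∈ p) (sym (x∈⁅y⁆⇒x≡y x y∈⁅x⁆)) x∈p
  where
  p⊆⁅x⁆ : p ⊆ ⁅ x ⁆
  p⊆⁅x⁆ {y} y∈p with y ≟ x
  ... | yes refl = x∈⁅x⁆ x
  ... | no y≢x   = contradiction (x∈p⇒0<∣p∣ (x∈p∧x≢y⇒x∈p-y y∈p y≢x))
                                 (<⇒≱ (subst (∣ p - x ∣ <_) ∣p∣≡1 (x∈p⇒∣p-x∣<∣p∣ x∈p)))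

Odd∣p∣⇒Nonempty : ∀ {k} {p : Subset k} → Odd ∣ p ∣ → Nonempty p
Odd∣p∣⇒Nonempty {k} {p} odd with nonempty? p
... | yes nonempty = nonempty
... | no  empty    = contradiction (subst Odd (cong ∣_∣ (Empty-unique empty)) odd)
                                   (subst (¬_ ∘ Odd) (sym (∣⊥∣≡0 k)) λ ())

∣∣-≤-injection : ∀ {k l} {A : Subset k} {B : Subset l} (R : Fin k → Fin l → Set) →
                 (∀ {a} → a ∈ A → Σ (Fin l) λ b → b ∈ B × R a b) →
                 (∀ {a a′ b} → R a b → R a′ b → a ≡ a′) → ∣ A ∣ ≤ ∣ B ∣
∣∣-≤-injection {A = []} R image injective = z≤n
∣∣-≤-injection {A = false ∷ A} R image injective =
  ∣∣-≤-injection (R ∘ suc) (image ∘ there) (λ r r′ → suc-injective (injective r r′))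
∣∣-≤-injection {A = true ∷ A} {B} R image injective with image here
... | b₀ , b₀∈B , Rb₀ =
  ≤-trans (s≤s (∣∣-≤-injection (R ∘ suc) image′ (λ r r′ → suc-injective (injective r r′))))
          (x∈p⇒∣p-x∣<∣p∣ b₀∈B)
  where
  image′ : ∀ {a} → a ∈ A → Σ (Fin _) λ b → b ∈ B - b₀ × R (suc a) b
  image′ a∈A with image (there a∈A)
  ... | b , b∈B , Rab = b , x∈p∧x≢y⇒x∈p-y b∈B (λ b≡b₀ → 0≢1+n (injective Rb₀ (subst (R _) b≡b₀ Rab))) , Rab

inflationary-fixpoint : ∀ {k} (f : Subset k → Subset k) → (∀ {S} → S ⊆ f S) →
                        (P : Subset k → Set) → (∀ {S} → P S → P (f S)) →
                        ∀ {S} → P S → Σ (Subset k) λ S* → S ⊆ S* × P S* × f S* ⊆ S*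
inflationary-fixpoint {k} f inflate P preserve {S} pS = go (suc k) S (s≤s (m≤m+n k ∣ S ∣)) pS
  where
  -- Every step that is not yet stable enlarges S, so k + 1 steps of fuel suffice.
  go : ∀ fuel S → k < fuel + ∣ S ∣ → P S → Σ (Subset k) λ S* → S ⊆ S* × P S* × f S* ⊆ S*
  go zero    S bound pS = contradiction (∣p∣≤n S) (<⇒≱ bound)
  go (suc fuel) S bound pS with any? (λ x → x ∈? f S ×-dec ¬? (x ∈? S))
  ... | no noNew =
    S , ⊆-refl , pS , λ {x} x∈fS → decidable-stable (x ∈? S) (λ x∉S → noNew (x , x∈fS , x∉S))
  ... | yes (x , x∈fS , x∉S) with go fuel (f S) bound′ (preserve pS)
    where
    open ≤-Reasoning
    bound′ : k < fuel + ∣ f S ∣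
    bound′ = begin-strict
      k                 <⟨ bound ⟩
      suc fuel + ∣ S ∣  ≡⟨ +-suc fuel ∣ S ∣ ⟨
      fuel + suc ∣ S ∣  ≤⟨ +-monoʳ-≤ fuel (p⊂q⇒∣p∣<∣q∣ (inflate , x , x∈fS , x∉S)) ⟩
      fuel + ∣ f S ∣    ∎
  ... | S* , fS⊆S* , pS* , closed = S* , ⊆-trans inflate fS⊆S* , pS* , closed

sum-tabulate : ∀ {k} (f : Fin k → ℕ) → ListAction.sum (List.tabulate f) ≡ sum f
sum-tabulate {zero}  f = refl
sum-tabulate {suc k} f = cong (f zero +_) (sum-tabulate (f ∘ suc))

module _ {n m} (G : Graph n m) where

  end₁ end₂ : Fin m → Fin n
  end₁ e = proj₁ (ends G e)
  end₂ e = proj₂ (ends G e)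

  Σₑ≡sum : ∀ f → Σₑ G f ≡ sum f
  Σₑ≡sum f = trans (cong ListAction.sum (map-tabulate id f)) (sum-tabulate f)

  ∈E[]⁺ : ∀ {U e} → end₁ e ∈ U → end₂ e ∈ U → e ∈ E[_] G U
  ∈E[]⁺ {U} {e} a∈U b∈U =
    lookup⇒∈ (trans (lookup∘tabulate (bothIn G U) e) (cong₂ _∧_ (∈⇒lookup a∈U) (∈⇒lookup b∈U)))

  ∈E[]⁻ : ∀ {U e} → e ∈ E[_] G U → end₁ e ∈ U × end₂ e ∈ U
  ∈E[]⁻ {U} {e} e∈E
    with lookup U (end₁ e) in a | lookup U (end₂ e) in b
       | trans (sym (lookup∘tabulate (bothIn G U) e)) (∈⇒lookup e∈E)
  ... | true  | true  | _  = lookup⇒∈ a , lookup⇒∈ b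
  ... | true  | false | ()
  ... | false | _     | ()

  Crosses : Subset n → Fin m → Set
  Crosses U e = (end₁ e ∈ U × end₂ e ∉ U) ⊎ (end₁ e ∉ U × end₂ e ∈ U)

  ∈δ⁺ : ∀ {U e} → Crosses U e → e ∈ δ G U
  ∈δ⁺ {U} {e} (inj₁ (a∈U , b∉U)) =
    lookup⇒∈ (trans (lookup∘tabulate (crosses G U) e) (cong₂ _xor_ (∈⇒lookup a∈U) (∉⇒lookup b∉U)))
  ∈δ⁺ {U} {e} (inj₂ (a∉U , b∈U)) =
    lookup⇒∈ (trans (lookup∘tabulate (crosses G U) e) (cong₂ _xor_ (∉⇒lookup a∉U) (∈⇒lookup b∈U)))

  ∈δ⁻ : ∀ {U e} → e ∈ δ G U → Crosses U e
  ∈δ⁻ {U} {e} e∈δ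
    with lookup U (end₁ e) in a | lookup U (end₂ e) in b
       | trans (sym (lookup∘tabulate (crosses G U) e)) (∈⇒lookup e∈δ)
  ... | true  | false | _ = inj₁ (lookup⇒∈ a , lookup⇒∉ b)
  ... | false | true  | _ = inj₂ (lookup⇒∉ a , lookup⇒∈ b)
  ... | true  | true  | ()
  ... | false | false | ()

  ∈δ⇒∉E[] : ∀ {U e} → e ∈ δ G U → e ∉ E[_] G U
  ∈δ⇒∉E[] {U} e∈δ e∈E with ∈δ⁻ {U} e∈δ | ∈E[]⁻ {U} e∈E
  ... | inj₁ (_ , b∉U) | _ , b∈U = b∉U b∈U
  ... | inj₂ (a∉U , _) | a∈U , _ = a∉U a∈U

  ∉E[]⇒∈δ : ∀ {U v e} → v ∈ U → EndOf G v e → e ∉ E[_] G U → e ∈ δ G U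
  ∉E[]⇒∈δ {U} {v} {e} v∈U v-end e∉E with end₁ e ∈? U | end₂ e ∈? U
  ... | yes a∈U | yes b∈U = contradiction (∈E[]⁺ a∈U b∈U) e∉E
  ... | yes a∈U | no  b∉U = ∈δ⁺ (inj₁ (a∈U , b∉U))
  ... | no  a∉U | yes b∈U = ∈δ⁺ (inj₂ (a∉U , b∈U))
  ∉E[]⇒∈δ v∈U (inj₁ refl) e∉E | no a∉U | no _ = contradiction v∈U a∉U
  ∉E[]⇒∈δ v∈U (inj₂ refl) e∉E | no _   | no b∉U = contradiction v∈U b∉U

  inc-nonEnd : ∀ {v e} → ¬ EndOf G v e → inc G v e ≡ 0
  inc-nonEnd {v} {e} ¬end with v ≟ end₁ e | v ≟ end₂ e
  ... | yes v≡a | _       = contradiction (inj₁ v≡a) ¬end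
  ... | no _    | yes v≡b = contradiction (inj₂ v≡b) ¬end
  ... | no _    | no _    = refl

  inc-end₁ : ∀ {v e} → v ≢ end₂ e → (v ≡ end₁ e × inc G v e ≡ 1) ⊎ (v ≢ end₁ e × inc G v e ≡ 0)
  inc-end₁ {v} {e} v≢b with v ≟ end₁ e | v ≟ end₂ e
  ... | _       | yes v≡b = contradiction v≡b v≢b
  ... | yes v≡a | no _    = inj₁ (v≡a , refl)
  ... | no v≢a  | no _    = inj₂ (v≢a , refl)

  inc-end₂ : ∀ {v e} → v ≢ end₁ e → (v ≡ end₂ e × inc G v e ≡ 1) ⊎ (v ≢ end₂ e × inc G v e ≡ 0)
  inc-end₂ {v} {e} v≢a with v ≟ end₁ e | v ≟ end₂ e
  ... | yes v≡a | _       = contradiction v≡a v≢a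
  ... | no _    | yes v≡b = inj₁ (v≡b , refl)
  ... | no _    | no v≢b  = inj₂ (v≢b , refl)

  inc-boundary : ∀ {U e r v} → e ∈ δ G U → r ∈ U → EndOf G r e → v ∈ U →
                 (v ≡ r × inc G v e ≡ 1) ⊎ (v ≢ r × inc G v e ≡ 0)
  inc-boundary {U} {e} {r} {v} e∈δ r∈U r-end v∈U with ∈δ⁻ {U} e∈δ | r-end
  ... | inj₁ (_ , b∉U) | inj₁ refl = inc-end₁ λ v≡b → b∉U (subst (_∈ U) v≡b v∈U)
  ... | inj₂ (a∉U , _) | inj₂ refl = inc-end₂ λ v≡a → a∉U (subst (_∈ U) v≡a v∈U)
  ... | inj₁ (_ , b∉U) | inj₂ refl = contradiction r∈U b∉U
  ... | inj₂ (a∉U , _) | inj₁ refl = contradiction r∈U a∉U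

  deg≡sumOver : ∀ A v → deg G A v ≡ sumOver A (inc G v)
  deg≡sumOver A v = Σₑ≡sum _

  deg-⊥ : ∀ v → deg G ⊥ v ≡ 0
  deg-⊥ v = trans (deg≡sumOver ⊥ v) (sumOver-⊥ (inc G v))

  deg-⁅⁆ : ∀ e v → deg G ⁅ e ⁆ v ≡ inc G v e
  deg-⁅⁆ e v = trans (deg≡sumOver ⁅ e ⁆ v) (sumOver-⁅⁆ e (inc G v))

  deg-∪ : ∀ {A B} v → Empty (A ∩ B) → deg G (A ∪ B) v ≡ deg G A v + deg G B v
  deg-∪ {A} {B} v disjoint = begin
    deg G (A ∪ B) v                           ≡⟨ deg≡sumOver (A ∪ B) v ⟩
    sumOver (A ∪ B) (inc G v)                 ≡⟨ sumOver-∪ (inc G v) disjoint ⟩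
    sumOver A (inc G v) + sumOver B (inc G v) ≡⟨ cong₂ _+_ (deg≡sumOver A v) (deg≡sumOver B v) ⟨
    deg G A v + deg G B v                     ∎
    where open ≡-Reasoning

  deg-split : ∀ A B v → deg G A v ≡ deg G (A ∩ B) v + deg G (A ∩ ∁ B) v
  deg-split A B v = begin
    deg G A v                                                   ≡⟨ deg≡sumOver A v ⟩
    sumOver A (inc G v)                                         ≡⟨ sumOver-split A B (inc G v) ⟩
    sumOver (A ∩ B) (inc G v) + sumOver (A ∩ ∁ B) (inc G v)     ≡⟨ cong₂ _+_ (deg≡sumOver (A ∩ B) v) (deg≡sumOver (A ∩ ∁ B) v) ⟨
    deg G (A ∩ B) v + deg G (A ∩ ∁ B) v                         ∎
    where open ≡-Reasoning

  deg-cong : ∀ {A B v} → (∀ e → EndOf G v e → (e ∈ A) ⇔ (e ∈ B)) → deg G A v ≡ deg G B v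
  deg-cong {A} {B} {v} agree = begin
    deg G A v           ≡⟨ deg≡sumOver A v ⟩
    sumOver A (inc G v) ≡⟨ sumOver-cong (inc G v) incident ⟩
    sumOver B (inc G v) ≡⟨ deg≡sumOver B v ⟨
    deg G B v           ∎
    where
    open ≡-Reasoning
    incident : ∀ e → inc G v e ≡ 0 ⊎ ((e ∈ A) ⇔ (e ∈ B))
    incident e with (v ≟ end₁ e) ⊎-dec (v ≟ end₂ e)
    ... | yes end = inj₂ (agree e end)
    ... | no ¬end = inj₁ (inc-nonEnd ¬end)

  deg-outside : ∀ {A U v} → (∀ e → e ∈ A → e ∈ E[_] G U) → v ∉ U → deg G A v ≡ 0
  deg-outside {A} {U} {v} A⊆E v∉U = trans (deg-cong none) (deg-⊥ v)
    where
    none : ∀ e → EndOf G v e → (e ∈ A) ⇔ (e ∈ ⊥)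
    none e (inj₁ refl) = (λ e∈A → contradiction (proj₁ (∈E[]⁻ (A⊆E e e∈A))) v∉U) , (λ e∈⊥ → contradiction e∈⊥ ∉⊥)
    none e (inj₂ refl) = (λ e∈A → contradiction (proj₂ (∈E[]⁻ (A⊆E e e∈A))) v∉U) , (λ e∈⊥ → contradiction e∈⊥ ∉⊥)

  deg-within : ∀ {U v} A → v ∈ U → deg G A v ≡ deg G (A ∩ E[_] G U) v + deg G (δ G U ∩ A) v
  deg-within {U} {v} A v∈U =
    trans (deg-split A (E[_] G U) v) (cong (deg G (A ∩ E[_] G U) v +_) (deg-cong outgoing))
    where
    outgoing : ∀ e → EndOf G v e → (e ∈ A ∩ ∁ (E[_] G U)) ⇔ (e ∈ δ G U ∩ A)
    outgoing e v-end =
        (λ h → let e∈A , e∈∁E = x∈p∩q⁻ A _ h in x∈p∩q⁺ (∉E[]⇒∈δ v∈U v-end (x∈∁p⇒x∉p e∈∁E) , e∈A))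
      , (λ h → let e∈δ , e∈A = x∈p∩q⁻ (δ G U) A h in x∈p∩q⁺ (e∈A , x∉p⇒x∈∁p (∈δ⇒∉E[] {U} e∈δ)))

  emptyCut⇒restriction-isJoinOn : ∀ {T F U} → IsJoin G T F → δ G U ∩ F ≡ ⊥ →
                                  IsJoinOn G U (T ∩ U) (F ∩ E[_] G U)
  emptyCut⇒restriction-isJoinOn {T} {F} {U} F-join cut≡⊥ =
    (λ e e∈J → proj₂ (x∈p∩q⁻ F _ e∈J)) , parity
    where
    parity : ∀ v → v ∈ U → Odd (deg G (F ∩ E[_] G U) v) ⇔ (v ∈ T ∩ U)
    parity v v∈U = ≡⇒Odd⇔ (sym deg-F) ⟨⇔⟩ F-join v ⟨⇔⟩ ∈∩⇔ v∈U
      where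
      open ≡-Reasoning
      deg-F : deg G F v ≡ deg G (F ∩ E[_] G U) v
      deg-F = begin
        deg G F v                                           ≡⟨ deg-within F v∈U ⟩
        deg G (F ∩ E[_] G U) v + deg G (δ G U ∩ F) v        ≡⟨ cong (λ S → deg G (F ∩ E[_] G U) v + deg G S v) cut≡⊥ ⟩
        deg G (F ∩ E[_] G U) v + deg G ⊥ v                  ≡⟨ cong (deg G (F ∩ E[_] G U) v +_) (deg-⊥ v) ⟩
        deg G (F ∩ E[_] G U) v + 0                          ≡⟨ +-identityʳ _ ⟩
        deg G (F ∩ E[_] G U) v                              ∎

  singleCut⇒restriction-isJoinOn : ∀ {T F U e r} → IsJoin G T F → δ G U ∩ F ≡ ⁅ e ⁆ →
                                   r ∈ U → EndOf G r e →
                                   IsJoinOn G U ((T ∩ U) Δ ⁅ r ⁆) (F ∩ E[_] G U)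
  singleCut⇒restriction-isJoinOn {T} {F} {U} {e} {r} F-join cut≡⁅e⁆ r∈U r-end =
    (λ e e∈J → proj₂ (x∈p∩q⁻ F _ e∈J)) , parity
    where
    J = F ∩ E[_] G U
    e∈δ : e ∈ δ G U
    e∈δ = proj₁ (x∈p∩q⁻ (δ G U) F (subst (e ∈_) (sym cut≡⁅e⁆) (x∈⁅x⁆ e)))
    deg-F : ∀ {v} → v ∈ U → deg G F v ≡ deg G J v + inc G v e
    deg-F {v} v∈U = begin
      deg G F v                          ≡⟨ deg-within F v∈U ⟩
      deg G J v + deg G (δ G U ∩ F) v    ≡⟨ cong (λ S → deg G J v + deg G S v) cut≡⁅e⁆ ⟩
      deg G J v + deg G ⁅ e ⁆ v          ≡⟨ cong (deg G J v +_) (deg-⁅⁆ e v) ⟩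
      deg G J v + inc G v e              ∎
      where open ≡-Reasoning
    parity : ∀ v → v ∈ U → Odd (deg G J v) ⇔ (v ∈ (T ∩ U) Δ ⁅ r ⁆)
    parity v v∈U with inc-boundary e∈δ r∈U r-end v∈U
    ... | inj₁ (refl , inc≡1) =
      Odd[d+1]⇔P⇒Odd[d]⇔¬P {deg G J v} (≡⇒Odd⇔ (sym (trans (deg-F v∈U) (cong (deg G J v +_) inc≡1))) ⟨⇔⟩ F-join v)
      ⟨⇔⟩ ¬-cong (∈∩⇔ v∈U) ⟨⇔⟩ ⇔-sym (∈Δ-∈ (x∈⁅x⁆ v))
    ... | inj₂ (v≢r , inc≡0) =
      ≡⇒Odd⇔ (sym (trans (deg-F v∈U) (trans (cong (deg G J v +_) inc≡0) (+-identityʳ _))))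
      ⟨⇔⟩ F-join v ⟨⇔⟩ ∈∩⇔ v∈U ⟨⇔⟩ ⇔-sym (∈Δ-∉ (x≢y⇒x∉⁅y⁆ v≢r))

  joinOn-parity : ∀ {U T′ A B} → IsJoinOn G U T′ A → IsJoinOn G U T′ B →
                  ∀ v → Odd (deg G A v) ⇔ Odd (deg G B v)
  joinOn-parity {U} (A⊆E , A-parity) (B⊆E , B-parity) v with v ∈? U
  ... | yes v∈U = A-parity v v∈U ⟨⇔⟩ ⇔-sym (B-parity v v∈U)
  ... | no  v∉U = ≡⇒Odd⇔ (trans (deg-outside A⊆E v∉U) (sym (deg-outside B⊆E v∉U)))

  -- Exchanging F ∩ E[ U ] for another join F′ of the same graft on U gives the join
  -- (F ∖ E[ U ]) ∪ F′ of (G, T).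
  restriction-isMinJoinOn : ∀ {T F U T′} → IsMinJoin G T F → IsJoinOn G U T′ (F ∩ E[_] G U) →
                            IsMinJoinOn G U T′ (F ∩ E[_] G U)
  restriction-isMinJoinOn {T} {F} {U} {T′} (F-join , F-min) J-join = J-join , minimal
    where
    J = F ∩ E[_] G U
    R = F ∩ ∁ (E[_] G U)
    minimal : ∀ F′ → IsJoinOn G U T′ F′ → ∣ J ∣ ≤ ∣ F′ ∣
    minimal F′ F′-join = +-cancelˡ-≤ (∣ R ∣) _ _ (begin
      ∣ R ∣ + ∣ J ∣   ≡⟨ +-comm (∣ R ∣) (∣ J ∣) ⟩
      ∣ J ∣ + ∣ R ∣   ≡⟨ ∣∣-split F (E[_] G U) ⟨
      ∣ F ∣           ≤⟨ F-min (R ∪ F′) exchanged-join ⟩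
      ∣ R ∪ F′ ∣      ≡⟨ ∣∪∣≡∣∣+∣∣ disjoint ⟩
      ∣ R ∣ + ∣ F′ ∣  ∎)
      where
      open ≤-Reasoning
      disjoint : Empty (R ∩ F′)
      disjoint (e , e∈R∩F′) with x∈p∩q⁻ R F′ e∈R∩F′
      ... | e∈R , e∈F′ = x∈∁p⇒x∉p (proj₂ (x∈p∩q⁻ F _ e∈R)) (proj₁ F′-join e e∈F′)
      exchanged-join : IsJoin G T (R ∪ F′)
      exchanged-join v =
        ≡⇒Odd⇔ (deg-∪ v disjoint)
        ⟨⇔⟩ Odd-+-congˡ (deg G R v) (joinOn-parity F′-join J-join v)
        ⟨⇔⟩ ≡⇒Odd⇔ (trans (+-comm (deg G R v) (deg G J v)) (sym (deg-split F (E[_] G U) v)))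
        ⟨⇔⟩ F-join v

module _ {n m} (G : Graph n m) (X : Subset n) where

  Adjacent : Fin n → Fin n → Set
  Adjacent u v = u ∉ X × v ∉ X × ∃ λ e → ends G e ≡ (u , v) ⊎ ends G e ≡ (v , u)

  adjacent? : ∀ u v → Dec (Adjacent u v)
  adjacent? u v = ¬? (u ∈? X) ×-dec ¬? (v ∈? X) ×-dec
                  any? λ e → ends G e ≟² (u , v) ⊎-dec ends G e ≟² (v , u)
    where _≟²_ = ≡-dec _≟_ _≟_

  adjacent⇒walk : ∀ {u v} → Adjacent u v → Walk G X u v
  adjacent⇒walk (u∉X , v∉X , e , e-ends) = step e e-ends u∉X v∉X here

  _++ʷ_ : ∀ {u v w} → Walk G X u v → Walk G X v w → Walk G X u w
  here                    ++ʷ q = q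
  step e e-ends u∉X v∉X p ++ʷ q = step e e-ends u∉X v∉X (p ++ʷ q)

  reverseʷ : ∀ {u v} → Walk G X u v → Walk G X v u
  reverseʷ p = reverse-onto p here
    where
    reverse-onto : ∀ {u v w} → Walk G X u v → Walk G X u w → Walk G X v w
    reverse-onto here                      acc = acc
    reverse-onto (step e e-ends u∉X v∉X p) acc = reverse-onto p (step e (swap e-ends) v∉X u∉X acc)

  AdjacencyClosed : Subset n → Set
  AdjacencyClosed S = ∀ {u v} → u ∈ S → Adjacent u v → v ∈ S

  walk-closed : ∀ {S u v} → AdjacencyClosed S → u ∈ S → Walk G X u v → v ∈ S
  walk-closed closed u∈S here                      = u∈S
  walk-closed closed u∈S (step e e-ends u∉X v∉X p) =
    walk-closed closed (closed u∈S (u∉X , v∉X , e , e-ends)) p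

  grows? : ∀ S v → Dec (v ∈ S ⊎ (∃ λ u → u ∈ S × Adjacent u v))
  grows? S v = v ∈? S ⊎-dec any? λ u → u ∈? S ×-dec adjacent? u v

  grow : Subset n → Subset n
  grow S = tabulate (does ∘ grows? S)

  ∈grow⁺ : ∀ {S v} → v ∈ S ⊎ (∃ λ u → u ∈ S × Adjacent u v) → v ∈ grow S
  ∈grow⁺ {S} {v} h = lookup⇒∈ (trans (lookup∘tabulate (does ∘ grows? S) v) (dec-true (grows? S v) h))

  ∈grow⁻ : ∀ {S v} → v ∈ grow S → v ∈ S ⊎ (∃ λ u → u ∈ S × Adjacent u v)
  ∈grow⁻ {S} {v} v∈grow =
    witness (grows? S v) (trans (sym (lookup∘tabulate (does ∘ grows? S) v)) (∈⇒lookup v∈grow))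
    where
    witness : ∀ {A : Set} (a? : Dec A) → does a? ≡ true → A
    witness (yes a) _ = a

  ReachableFrom : Fin n → Subset n → Set
  ReachableFrom q S = ∀ {v} → v ∈ S → v ∉ X × Walk G X q v

  component-of : ∀ q → q ∉ X → Σ (Subset n) λ U → IsComponent G X U × q ∈ U
  component-of q q∉X
    with inflationary-fixpoint grow (∈grow⁺ ∘ inj₁) (ReachableFrom q) grow-reachable {⁅ q ⁆} start
    where
    start : ReachableFrom q ⁅ q ⁆
    start v∈⁅q⁆ rewrite x∈⁅y⁆⇒x≡y q v∈⁅q⁆ = q∉X , here
    grow-reachable : ∀ {S} → ReachableFrom q S → ReachableFrom q (grow S)
    grow-reachable reach v∈grow with ∈grow⁻ v∈grow
    ... | inj₁ v∈S                           = reach v∈S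
    ... | inj₂ (u , u∈S , adj@(_ , v∉X , _)) = v∉X , proj₂ (reach u∈S) ++ʷ adjacent⇒walk adj
  ... | U , ⁅q⁆⊆U , reach , grow⊆U = U , isComponent , ⁅q⁆⊆U (x∈⁅x⁆ q)
    where
    closed : AdjacencyClosed U
    closed u∈U adj = grow⊆U (∈grow⁺ (inj₂ (_ , u∈U , adj)))
    isComponent : IsComponent G X U
    isComponent = (q , ⁅q⁆⊆U (x∈⁅x⁆ q))
                , (λ u u∈U → proj₁ (reach u∈U))
                , (λ u v u∈U v∈U → reverseʷ (proj₂ (reach u∈U)) ++ʷ proj₂ (reach v∈U))
                , (λ u v u∈U _ p → walk-closed closed u∈U p)

  components-meet⇒≡ : ∀ {U U′ w} → IsComponent G X U → IsComponent G X U′ → w ∈ U → w ∈ U′ → U ≡ U′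
  components-meet⇒≡ {w = w} (_ , avoids , walks , closed) (_ , avoids′ , walks′ , closed′) w∈U w∈U′ =
    ⊆-antisym (λ {u} u∈U → closed′ w u w∈U′ (avoids u u∈U) (walks w u w∈U u∈U))
              (λ {u} u∈U′ → closed w u w∈U (avoids′ u u∈U′) (walks′ w u w∈U′ u∈U′))

  component-boundary : ∀ {U e} → IsComponent G X U → e ∈ δ G U →
                       (end₁ G e ∈ U × end₂ G e ∈ X) ⊎ (end₂ G e ∈ U × end₁ G e ∈ X)
  component-boundary {U} {e} (_ , avoids , _ , closed) e∈δ with ∈δ⁻ G {U} e∈δ
  ... | inj₁ (a∈U , b∉U) = inj₁ (a∈U , decidable-stable (end₂ G e ∈? X) λ b∉X →
          b∉U (closed _ _ a∈U b∉X (adjacent⇒walk (avoids _ a∈U , b∉X , e , inj₁ refl))))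
  ... | inj₂ (a∉U , b∈U) = inj₂ (b∈U , decidable-stable (end₁ G e ∈? X) λ a∉X →
          a∉U (closed _ _ b∈U a∉X (adjacent⇒walk (avoids _ b∈U , a∉X , e , inj₂ refl))))

  boundary-determines-component : ∀ {U U′ e} → IsComponent G X U → IsComponent G X U′ →
                                  e ∈ δ G U → e ∈ δ G U′ → U ≡ U′
  boundary-determines-component c c′ e∈δU e∈δU′
    with component-boundary c e∈δU | component-boundary c′ e∈δU′
  ... | inj₁ (a∈U , _)   | inj₁ (a∈U′ , _)  = components-meet⇒≡ c c′ a∈U a∈U′
  ... | inj₂ (b∈U , _)   | inj₂ (b∈U′ , _)  = components-meet⇒≡ c c′ b∈U b∈U′
  ... | inj₁ (_ , b∈X)   | inj₂ (b∈U′ , _)  = contradiction b∈X (proj₁ (proj₂ c′) _ b∈U′)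
  ... | inj₂ (_ , a∈X)   | inj₁ (a∈U′ , _)  = contradiction a∈X (proj₁ (proj₂ c′) _ a∈U′)

module _ {n m} (G : Graph n m) {T : Subset n} {F : Subset m} {X : Subset n}
         (F-join : IsJoin G T F) (combic : IsCombic G T F X) where

  private
    noEdgeInX : ∀ e → e ∈ F → e ∉ E[_] G X
    noEdgeInX = proj₁ combic
    oddCut : ∀ U → OddComp G T X U → cut G F U ≡ 1
    oddCut = proj₁ (proj₂ combic)
    evenCut : ∀ U → EvenComp G T X U → cut G F U ≡ 0
    evenCut = proj₂ (proj₂ combic)

  crossing⇒oddComponent : ∀ {U e} → IsComponent G X U → e ∈ F → e ∈ δ G U → OddComp G T X U
  crossing⇒oddComponent {U} c e∈F e∈δ with odd? ∣ T ∩ U ∣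
  ... | yes odd  = c , odd
  ... | no  even =
    contradiction (subst (0 <_) (evenCut U (c , even)) (x∈p⇒0<∣p∣ (x∈p∩q⁺ (e∈δ , e∈F)))) λ ()

  edgeAtX⇒oddCut : ∀ {x e} → x ∈ X → e ∈ F → EndOf G x e →
                   Σ (Subset n) λ U → OddComp G T X U × e ∈ δ G U
  edgeAtX⇒oddCut {e = e} x∈X e∈F (inj₁ refl) with end₂ G e ∈? X
  ... | yes b∈X = contradiction (∈E[]⁺ G x∈X b∈X) (noEdgeInX e e∈F)
  ... | no  b∉X with component-of G X (end₂ G e) b∉X
  ... | U , c , b∈U = U , crossing⇒oddComponent c e∈F e∈δ , e∈δ
    where
    e∈δ : e ∈ δ G U
    e∈δ = ∈δ⁺ G (inj₂ ((λ a∈U → proj₁ (proj₂ c) _ a∈U x∈X) , b∈U))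
  edgeAtX⇒oddCut {e = e} x∈X e∈F (inj₂ refl) with end₁ G e ∈? X
  ... | yes a∈X = contradiction (∈E[]⁺ G a∈X x∈X) (noEdgeInX e e∈F)
  ... | no  a∉X with component-of G X (end₁ G e) a∉X
  ... | U , c , a∈U = U , crossing⇒oddComponent c e∈F e∈δ , e∈δ
    where
    e∈δ : e ∈ δ G U
    e∈δ = ∈δ⁺ G (inj₁ (a∈U , λ b∈U → proj₁ (proj₂ c) _ b∈U x∈X))

  module _ (F′ : Subset m)
           (F′-def : ∀ e → (e ∈ F′) ⇔ (e ∈ F × Σ (Subset n) λ U → OddComp G T X U × e ∈ δ G U)) where

    F′⊆skeleton : ∀ e → e ∈ F′ → SkEdge G T X e
    F′⊆skeleton e e∈F′ with proj₁ (F′-def e) e∈F′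
    ... | _ , U , oc , e∈δ with component-boundary G X (proj₁ oc) e∈δ
    ... | inj₁ (a∈U , b∈X) = inj₂ (b∈X , U , oc , a∈U)
    ... | inj₂ (b∈U , a∈X) = inj₁ (a∈X , U , oc , b∈U)

    deg-F′≡deg-F : ∀ {x} → x ∈ X → deg G F′ x ≡ deg G F x
    deg-F′≡deg-F x∈X = deg-cong G λ e x-end →
      proj₁ ∘ proj₁ (F′-def e) , λ e∈F → proj₂ (F′-def e) (e∈F , edgeAtX⇒oddCut x∈X e∈F x-end)

    δ∩F′≡δ∩F : ∀ {U} → OddComp G T X U → δ G U ∩ F′ ≡ δ G U ∩ F
    δ∩F′≡δ∩F {U} oc = ⊆-antisym
      (λ h → let e∈δ , e∈F′ = x∈p∩q⁻ (δ G U) F′ h in x∈p∩q⁺ (e∈δ , proj₁ (proj₁ (F′-def _) e∈F′)))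
      (λ h → let e∈δ , e∈F = x∈p∩q⁻ (δ G U) F h in x∈p∩q⁺ (e∈δ , proj₂ (F′-def _) (e∈F , U , oc , e∈δ)))

    F′-isSkJoin : IsSkJoin G T X F′
    F′-isSkJoin = F′⊆skeleton
                , (λ x x∈X → ≡⇒Odd⇔ (deg-F′≡deg-F x∈X) ⟨⇔⟩ F-join x)
                , λ U oc → (λ _ → proj₂ oc)
                         , (λ _ → subst Odd (sym (trans (cong ∣_∣ (δ∩F′≡δ∩F oc)) (oddCut U oc))) refl)

    -- A skeleton edge lies in the cut of only one odd component, and that cut meets F in a
    -- single edge, so sending a ∈ F′ to an edge of F″ in the same odd cut is injective.
    F′-minimal : ∀ F″ → IsSkJoin G T X F″ → ∣ F′ ∣ ≤ ∣ F″ ∣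
    F′-minimal F″ (_ , _ , F″-cuts) = ∣∣-≤-injection SharesOddCut image injective
      where
      SharesOddCut : Fin m → Fin m → Set
      SharesOddCut a b = Σ (Subset n) λ U → OddComp G T X U × a ∈ δ G U ∩ F × b ∈ δ G U
      image : ∀ {a} → a ∈ F′ → Σ (Fin m) λ b → b ∈ F″ × SharesOddCut a b
      image a∈F′ with proj₁ (F′-def _) a∈F′
      ... | a∈F , U , oc , a∈δ with Odd∣p∣⇒Nonempty (proj₂ (F″-cuts U oc) (proj₂ oc))
      ... | b , b∈cut = b , proj₂ (x∈p∩q⁻ (δ G U) F″ b∈cut)
                      , U , oc , x∈p∩q⁺ (a∈δ , a∈F) , proj₁ (x∈p∩q⁻ (δ G U) F″ b∈cut)
      injective : ∀ {a a′ b} → SharesOddCut a b → SharesOddCut a′ b → a ≡ a′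
      injective (U , oc , a∈cut , b∈δ) (U′ , oc′ , a′∈cut , b∈δ′)
        with boundary-determines-component G X (proj₁ oc) (proj₁ oc′) b∈δ b∈δ′
      ... | refl = sym (x∈⁅y⁆⇒x≡y _ (subst (_ ∈_) (∣p∣≡1⇒p≡⁅x⁆ (oddCut U oc) a∈cut) a′∈cut))

    F′-isSkMinJoin : IsSkMinJoin G T X F′
    F′-isSkMinJoin = F′-isSkJoin , F′-minimal

lemma2p2 : ∀ {n m} (G : Graph n m) (T : Subset n) (F : Subset m) (X : Subset n) →
    IsMinJoin G T F → IsCombic G T F X →
    -- (i)
    (∀ U → OddComp G T X U → ∀ (e : Fin m) (r : Fin n) →
      e ∈ F → e ∈ δ G U → r ∈ U → EndOf G r e →
      IsMinJoinOn G U ((T ∩ U) Δ ⁅ r ⁆) (F ∩ E[_] G U))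
    -- (ii)
    × (∀ U → EvenComp G T X U → IsMinJoinOn G U (T ∩ U) (F ∩ E[_] G U))
    -- (iii)
    × (∀ (F' : Subset m) →
         (∀ e → (e ∈ F') ⇔ (e ∈ F × Σ (Subset n) λ U → OddComp G T X U × e ∈ δ G U)) →
         IsSkMinJoin G T X F')
lemma2p2 G T F X minF@(F-join , _) combic@(_ , oddCut , evenCut) =
    (λ U oc e r e∈F e∈δ r∈U r-end →
       restriction-isMinJoinOn G minF
         (singleCut⇒restriction-isJoinOn G F-join (∣p∣≡1⇒p≡⁅x⁆ (oddCut U oc) (x∈p∩q⁺ (e∈δ , e∈F))) r∈U r-end))
  , (λ U ec → restriction-isMinJoinOn G minF
                (emptyCut⇒restriction-isJoinOn G F-join (∣p∣≡0⇒p≡⊥ (evenCut U ec))))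
  , λ F′ F′-def → F′-isSkMinJoin G F-join combic F′ F′-def
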